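{- Let $G$ be a simple graph containing an arm with consecutive vertices $v_1,\dots,v_n$, and let $p$ be a pebble distribution on $G$ such that $p(v_i)\ge2$ for some $i\in\{1,\dots,n-1\}$, $p(v_n)=0$, and $p(v_j)\ge1$ for all $j\in\{1,\dots,n-1\}$. Let $q$ be obtained from $p$ by the single rolling move from $v_i$ to $v_n$, i.e. $q(v_i)=p(v_i)-1$, $q(v_n)=1$ and $q(x)=p(x)$ for all other $x$. If a vertex $u\in V(G)$ is reachable from $p$, then $u$ is also reachable from $q$.
   Context: An arm of $G$ is the subgraph induced by the vertices $v_1,\dots,v_n$ of a path (consecutive in that order) such that $v_1$ has degree 1 in $G$ and $v_2,\dots,v_{n-1}$ all have degree 2 in $G$. A pebble distribution on $G$ is a function $p:V(G)\to\mathbb{Z}_{\ge0}$. If $\{a,b\}\in E(G)$, the pebbling move $(a,a\to b)$ removes two pebbles at $a$ and adds one at $b$. If $a\ne c$ and $\{a,b\},\{c,b\}\in E(G)$, the strict rubbling move $(a,c\to b)$ removes one pebble at each of $a$ and $c$ and adds one at $b$. A rubbling move is either of these. A vertex $x$ is reachable from $p$ if there is a sequence of rubbling moves, with pebble counts never becoming negative, after which $x$ has at least one pebble. -}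

module Defs where

open import Data.Nat using (ℕ; zero; suc; _+_; _∸_; _≤_; _<_)
open import Data.Bool using (Bool; true; false; if_then_else_)
open import Data.Fin using (Fin; toℕ; inject₁; fromℕ)
open import Data.Fin.Properties using (_≟_)
open import Data.List using (List; length; filter; allFin)
open import Data.Product using (∃; _×_; _,_)
open import Relation.Nullary using (¬_)
open import Relation.Nullary.Decidable using (⌊_⌋)
open import Relation.Binary.PropositionalEquality using (_≡_; _≢_)
open import Relation.Binary.Construct.Closure.ReflexiveTransitive using (Star)
open import Function.Definitions using (Injective)

record Graph (N : ℕ) : Set where
  field
    adj   : Fin N → Fin N → Bool
    sym   : ∀ x y → adj x y ≡ adj y x
    irrefl : ∀ x → adj x x ≡ false

open Graph public

Adj : ∀ {N} → Graph N → Fin N → Fin N → Set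
Adj G x y = adj G x y ≡ true

degree : ∀ {N} → Graph N → Fin N → ℕ
degree {N} G x = length (filter (λ y → Data.Bool._≟_ (adj G x y) true) (allFin N))

-- An arm with n = suc m consecutive vertices v₁,…,vₙ given (0-indexed) by
-- v : Fin (suc m) → Fin N: distinct vertices, consecutive ones adjacent,
-- v₁ (index 0) has degree 1, v₂,…,vₙ₋₁ (indices 1..m-1) have degree 2.
record IsArm {N : ℕ} (G : Graph N) (m : ℕ) (v : Fin (suc m) → Fin N) : Set where
  field
    distinct : Injective _≡_ _≡_ v
    path     : ∀ (k : Fin m) → Adj G (v (inject₁ k)) (v (Data.Fin.suc k))
    endDeg   : degree G (v Data.Fin.zero) ≡ 1
    innerDeg : ∀ (k : Fin (suc m)) → 0 < toℕ k → toℕ k < m → degree G (v k) ≡ 2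

Distribution : ℕ → Set
Distribution N = Fin N → ℕ

remove : ∀ {N} → Fin N → Distribution N → Distribution N
remove a p x = if ⌊ x ≟ a ⌋ then p x ∸ 1 else p x

add : ∀ {N} → Fin N → Distribution N → Distribution N
add b p x = if ⌊ x ≟ b ⌋ then suc (p x) else p x

data Step {N : ℕ} (G : Graph N) : Distribution N → Distribution N → Set where
  pebbling : ∀ {p} a b → Adj G a b → 2 ≤ p a →
             Step G p (add b (remove a (remove a p)))
  strict   : ∀ {p} a c b → a ≢ c → Adj G a b → Adj G c b → 1 ≤ p a → 1 ≤ p c →
             Step G p (add b (remove a (remove c p)))

Reachable : ∀ {N} → Graph N → Distribution N → Fin N → Set
Reachable G p x = ∃ λ p' → Star (Step G) p p' × 1 ≤ p' x

-- Run the moves from p and from q side by side, keeping the distribution b reached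
-- from q at least the distribution a reached from p, except that one pebble of a at
-- some arm vertex w may have rolled to the tip vₙ in b.  A move taking no pebble from
-- w is copied verbatim.  A move taking a pebble from an inner arm vertex w is not
-- copied at all: v₁,…,vₙ₋₁ have no neighbours off the arm, so its target is again an
-- arm vertex, and the pebble it places there takes over the role of the rolled pebble
-- (or cancels it when the target is the tip).  So in the end b ≥ a off the inner arm,
-- while the inner arm vertices are occupied in q from the start.
module Submission where

open import Defs hiding (sym)
open import Data.Nat using (ℕ; zero; suc; _+_; _≤_; z≤n; s≤s)
open import Data.Nat.Properties
  using (+-comm; +-assoc; +-identityʳ; +-cancelʳ-≤; +-monoˡ-≤; +-monoʳ-≤; ≤-reflexive; ≤-trans;
         m≤m+n; m≤n+m; m<n+m; <⇒≢; ∸-monoˡ-≤; m∸n+n≡m; +-commutativeSemigroup; module ≤-Reasoning)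
open import Algebra.Properties.CommutativeSemigroup +-commutativeSemigroup
  using (xy∙z≈xz∙y)
open import Data.Bool using (true; if_then_else_) renaming (_≟_ to _≟ᵇ_)
open import Data.Fin using (Fin; toℕ; inject₁; fromℕ) renaming (zero to fzero; suc to fsuc)
open import Data.Fin.Properties using (_≟_; any?; toℕ-inject₁; inject₁ℕ<)
open import Data.List using (List; []; _∷_; length)
open import Data.List.Properties using (length-removeAt′)
open import Data.List.Membership.Propositional using (_∈_)
open import Data.List.Membership.Propositional.Properties using (∈-filter⁺; ∈-allFin)
open import Data.List.Relation.Unary.Any using (here; there; index; _─_)
open import Data.List.Relation.Unary.All as All using (All; []; _∷_)
open import Data.List.Relation.Unary.AllPairs using ([]; _∷_)
open import Data.List.Relation.Unary.Unique.Propositional using (Unique)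
open import Data.List.Relation.Binary.Subset.Propositional using (_⊆_)
open import Data.Product using (∃; _×_; _,_)
open import Data.Sum using (_⊎_; inj₁; inj₂)
open import Function using (_∘_)
open import Relation.Nullary using (¬_; yes; no; contradiction)
open import Relation.Nullary.Decidable using (⌊_⌋)
open import Relation.Binary.PropositionalEquality
  using (_≡_; _≢_; refl; sym; trans; cong; cong₂; subst; module ≡-Reasoning)
open import Relation.Binary.Construct.Closure.ReflexiveTransitive using (Star; ε; _◅_; _◅◅_)

∈-─ : ∀ {A : Set} {x y : A} {ys : List A} (x∈ys : x ∈ ys) → y ∈ ys → y ≢ x → y ∈ (ys ─ x∈ys)
∈-─ (here refl) (here refl) y≢x = contradiction refl y≢x
∈-─ (here _)    (there y∈)  _   = y∈
∈-─ (there _)   (here y≡)   _   = here y≡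
∈-─ (there x∈)  (there y∈)  y≢x = there (∈-─ x∈ y∈ y≢x)

Unique-⊆⇒length-≤ : ∀ {A : Set} {xs ys : List A} → Unique xs → xs ⊆ ys → length xs ≤ length ys
Unique-⊆⇒length-≤ [] _ = z≤n
Unique-⊆⇒length-≤ {ys = ys} (x≢xs ∷ uniq) xs⊆ys =
  subst (_ ≤_) (sym (length-removeAt′ ys (index x∈ys)))
    (s≤s (Unique-⊆⇒length-≤ uniq
      (λ z∈xs → ∈-─ x∈ys (xs⊆ys (there z∈xs)) (All.lookup x≢xs z∈xs ∘ sym))))
  where x∈ys = xs⊆ys (here refl)

shift-≤ : ∀ a a′ b b′ {s t x y : ℕ} →
  a′ + s ≡ a + t → b′ + s ≡ b + t → a + x ≤ b + y → a′ + x ≤ b′ + y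
shift-≤ a a′ b b′ {s} {t} {x} {y} a-step b-step a≤b = +-cancelʳ-≤ s _ _ (begin
  a′ + x + s  ≡⟨ xy∙z≈xz∙y a′ x s ⟩
  a′ + s + x  ≡⟨ cong (_+ x) a-step ⟩
  a + t + x   ≡⟨ xy∙z≈xz∙y a t x ⟩
  a + x + t   ≤⟨ +-monoˡ-≤ t a≤b ⟩
  b + y + t   ≡⟨ xy∙z≈xz∙y b y t ⟩
  b + t + y   ≡⟨ cong (_+ y) b-step ⟨
  b′ + s + y  ≡⟨ xy∙z≈xz∙y b′ s y ⟩
  b′ + y + s  ∎)
  where open ≤-Reasoning

absorb-≤ : ∀ a a′ b {s t w x : ℕ} →
  a′ + s ≡ a + t → w ≤ s → a + x ≤ b + w → a′ + x ≤ b + t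
absorb-≤ a a′ b {s} {t} {w} {x} a-step w≤s a≤b = +-cancelʳ-≤ w _ _ (begin
  a′ + x + w  ≤⟨ +-monoʳ-≤ (a′ + x) w≤s ⟩
  a′ + x + s  ≡⟨ xy∙z≈xz∙y a′ x s ⟩
  a′ + s + x  ≡⟨ cong (_+ x) a-step ⟩
  a + t + x   ≡⟨ xy∙z≈xz∙y a t x ⟩
  a + x + t   ≤⟨ +-monoˡ-≤ t a≤b ⟩
  b + w + t   ≡⟨ xy∙z≈xz∙y b w t ⟩
  b + t + w   ∎)
  where open ≤-Reasoning

module _ {N : ℕ} where

  private variable
    G : Graph N
    a a′ : Distribution N

  indicator : Fin N → Fin N → ℕ
  indicator x z = if ⌊ z ≟ x ⌋ then 1 else 0

  indicator-≡ : ∀ x → indicator x x ≡ 1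
  indicator-≡ x with x ≟ x
  ... | yes _   = refl
  ... | no x≢x = contradiction refl x≢x

  indicator-≢ : ∀ {x z} → z ≢ x → indicator x z ≡ 0
  indicator-≢ {x = x} {z = z} z≢x with z ≟ x
  ... | yes z≡x = contradiction z≡x z≢x
  ... | no _    = refl

  add-≡ : ∀ y (r : Distribution N) z → add y r z ≡ r z + indicator y z
  add-≡ y r z with z ≟ y
  ... | yes _ = +-comm 1 (r z)
  ... | no _  = sym (+-identityʳ (r z))

  remove-+-indicator : ∀ x (r : Distribution N) → 1 ≤ r x → ∀ z → remove x r z + indicator x z ≡ r z
  remove-+-indicator x r 1≤rx z with z ≟ x
  ... | yes refl = m∸n+n≡m 1≤rx
  ... | no _     = +-identityʳ (r z)

  remove-≢ : ∀ {x z} (r : Distribution N) → z ≢ x → remove x r z ≡ r z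
  remove-≢ {x = x} {z = z} r z≢x with z ≟ x
  ... | yes z≡x = contradiction z≡x z≢x
  ... | no _    = refl

  remove-≥1 : ∀ {x} (r : Distribution N) → 2 ≤ r x → ∀ z → 1 ≤ r z → 1 ≤ remove x r z
  remove-≥1 {x = x} r 2≤rx z 1≤rz with z ≟ x
  ... | yes refl = ∸-monoˡ-≤ 1 2≤rx
  ... | no _     = 1≤rz

  ≤-add : ∀ y (r : Distribution N) z → r z ≤ add y r z
  ≤-add y r z = subst (r z ≤_) (sym (add-≡ y r z)) (m≤m+n (r z) _)

  remove₂-+-indicators : ∀ s c (r : Distribution N) → 1 ≤ r c × 1 ≤ remove c r s → ∀ z →
    remove s (remove c r) z + (indicator s z + indicator c z) ≡ r z
  remove₂-+-indicators s c r (1≤rc , 1≤r's) z = begin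
    remove s r′ z + (indicator s z + indicator c z) ≡⟨ +-assoc (remove s r′ z) _ _ ⟨
    remove s r′ z + indicator s z + indicator c z   ≡⟨ cong (_+ indicator c z) (remove-+-indicator s r′ 1≤r's z) ⟩
    r′ z + indicator c z                            ≡⟨ remove-+-indicator c r 1≤rc z ⟩
    r z                                             ∎
    where
    open ≡-Reasoning
    r′ = remove c r

  transfer-balance : ∀ s c y (r : Distribution N) → 1 ≤ r c × 1 ≤ remove c r s → ∀ z →
    add y (remove s (remove c r)) z + (indicator s z + indicator c z) ≡ r z + indicator y z
  transfer-balance s c y r available z = begin
    add y r′ z + δ                ≡⟨ cong (_+ δ) (add-≡ y r′ z) ⟩
    r′ z + indicator y z + δ      ≡⟨ xy∙z≈xz∙y (r′ z) _ _ ⟩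
    r′ z + δ + indicator y z      ≡⟨ cong (_+ indicator y z) (remove₂-+-indicators s c r available z) ⟩
    r z + indicator y z           ∎
    where
    open ≡-Reasoning
    r′ = remove s (remove c r)
    δ  = indicator s z + indicator c z

  source₁ source₂ target : Step G a a′ → Fin N
  source₁ (pebbling s _ _ _)         = s
  source₁ (strict s _ _ _ _ _ _ _)   = s
  source₂ (pebbling s _ _ _)         = s
  source₂ (strict _ c _ _ _ _ _ _)   = c
  target  (pebbling _ y _ _)         = y
  target  (strict _ _ y _ _ _ _ _)   = y

  consumed : Step G a a′ → Fin N → ℕ
  consumed st z = indicator (source₁ st) z + indicator (source₂ st) z

  source₁-adjacent : (st : Step G a a′) → Adj G (source₁ st) (target st)
  source₁-adjacent (pebbling _ _ adj _)       = adj
  source₁-adjacent (strict _ _ _ _ adj _ _ _) = adj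

  source₂-adjacent : (st : Step G a a′) → Adj G (source₂ st) (target st)
  source₂-adjacent (pebbling _ _ adj _)       = adj
  source₂-adjacent (strict _ _ _ _ _ adj _ _) = adj

  sources-available : (st : Step G a a′) →
    1 ≤ a (source₂ st) × 1 ≤ remove (source₂ st) a (source₁ st)
  sources-available {a = a} (pebbling s _ _ 2≤as) = 1≤as , remove-≥1 a 2≤as s 1≤as
    where 1≤as = ≤-trans (s≤s z≤n) 2≤as
  sources-available {a = a} (strict _ _ _ s≢c _ _ 1≤as 1≤ac) =
    1≤ac , subst (1 ≤_) (sym (remove-≢ a s≢c)) 1≤as

  step-balance : (st : Step G a a′) → ∀ z → a′ z + consumed st z ≡ a z + indicator (target st) z
  step-balance {a = a} st@(pebbling s y _ _)         = transfer-balance s s y a (sources-available st)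
  step-balance {a = a} st@(strict s c y _ _ _ _ _)   = transfer-balance s c y a (sources-available st)

  consumed-≤ : (st : Step G a a′) → ∀ z → consumed st z ≤ a z
  consumed-≤ {a = a} st z =
    subst (consumed st z ≤_)
      (remove₂-+-indicators (source₁ st) (source₂ st) a (sources-available st) z)
      (m≤n+m (consumed st z) (remove (source₁ st) (remove (source₂ st) a) z))

  source₁-≤-consumed : (st : Step G a a′) → ∀ z → indicator (source₁ st) z ≤ consumed st z
  source₁-≤-consumed st z = m≤m+n _ _

  source₂-≤-consumed : (st : Step G a a′) → ∀ z → indicator (source₂ st) z ≤ consumed st z
  source₂-≤-consumed st z = m≤n+m _ _

  replay : (st : Step G a a′) → ∀ {b} → (∀ z → consumed st z ≤ b z) →
    ∃ λ b′ → Step G b b′ × (∀ z → b′ z + consumed st z ≡ b z + indicator (target st) z)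
  replay (pebbling s y s~y _) {b} enough = _ , st′ , step-balance st′
    where
    st′ = pebbling s y s~y (subst (_≤ b s) (cong₂ _+_ (indicator-≡ s) (indicator-≡ s)) (enough s))
  replay st@(strict s c y s≢c s~y c~y _ _) {b} enough = _ , st′ , step-balance st′
    where
    available : ∀ x → indicator x x ≤ consumed st x → 1 ≤ b x
    available x ≤consumed = subst (_≤ b x) (indicator-≡ x) (≤-trans ≤consumed (enough x))
    st′ = strict s c y s≢c s~y c~y (available s (source₁-≤-consumed st s))
                                   (available c (source₂-≤-consumed st c))


module Rolling {N : ℕ} (G : Graph N) (tip : Fin N) (Inner : Fin N → Set)
  (inner-closed : ∀ {w t} → Inner w → Adj G w t → t ≡ tip ⊎ Inner t) where

  private variable
    a a′ b : Distribution N
    w : Fin N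

  -- b dominates a once one pebble of a at w is rolled to the tip; for w = tip
  -- this is plain pointwise domination.
  _≼[_]_ : Distribution N → Fin N → Distribution N → Set
  a ≼[ w ] b = ∀ z → a z + indicator tip z ≤ b z + indicator w z

  Anchor : Fin N → Set
  Anchor w = w ≡ tip ⊎ Inner w

  Tracks : Distribution N → Distribution N → Set
  Tracks b a = ∃ λ w → Anchor w × a ≼[ w ] b

  Simulated : Distribution N → Distribution N → Set
  Simulated b a = ∃ λ b′ → Star (Step G) b b′ × Tracks b′ a

  ≼[tip]⇒≤ : a ≼[ tip ] b → ∀ z → a z ≤ b z
  ≼[tip]⇒≤ a≼b z = +-cancelʳ-≤ (indicator tip z) _ _ (a≼b z)

  ≼[_]⇒≤ : ∀ w → a ≼[ w ] b → ∀ {z} → z ≢ w → a z ≤ b z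
  ≼[_]⇒≤ {a = a} {b = b} w a≼b {z} z≢w = ≤-trans (m≤m+n (a z) _)
    (subst (a z + indicator tip z ≤_)
      (trans (cong (b z +_) (indicator-≢ z≢w)) (+-identityʳ (b z))) (a≼b z))

  roll-≼ : ∀ (p : Distribution N) → 1 ≤ p w → p ≼[ w ] add tip (remove w p)
  roll-≼ {w = w} p 1≤pw z = ≤-reflexive (begin
    p z + indicator tip z
      ≡⟨ cong (_+ indicator tip z) (remove-+-indicator w p 1≤pw z) ⟨
    remove w p z + indicator w z + indicator tip z
      ≡⟨ xy∙z≈xz∙y (remove w p z) _ _ ⟩
    remove w p z + indicator tip z + indicator w z
      ≡⟨ cong (_+ indicator w z) (add-≡ tip (remove w p) z) ⟨
    add tip (remove w p) z + indicator w z
      ∎)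
    where open ≡-Reasoning

  replay-tracking : Anchor w → a ≼[ w ] b → (st : Step G a a′) → (∀ z → consumed st z ≤ b z) →
    Simulated b a′
  replay-tracking {w = w} {a = a} {b = b} {a′ = a′} anchor a≼b st enough with replay st enough
  ... | b′ , st′ , balance =
    b′ , st′ ◅ ε , w , anchor ,
    λ z → shift-≤ (a z) (a′ z) (b z) (b′ z) (step-balance st z) (balance z) (a≼b z)

  -- The pebble rolled from w is the one st takes from w, so b need not move.
  absorb-tracking : Inner w → a ≼[ w ] b → (st : Step G a a′) →
    Adj G w (target st) → (∀ z → indicator w z ≤ consumed st z) → Simulated b a′
  absorb-tracking {a = a} {b = b} {a′ = a′} inner a≼b st w~y w≤consumed =
    _ , ε , target st , inner-closed inner w~y ,
    λ z → absorb-≤ (a z) (a′ z) (b z) (step-balance st z) (w≤consumed z) (a≼b z)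

  unconsumed-available : a ≼[ w ] b → (st : Step G a a′) → consumed st w ≡ 0 →
    ∀ z → consumed st z ≤ b z
  unconsumed-available {w = w} {b = b} a≼b st none z with z ≟ w
  ... | yes refl = subst (_≤ b z) (sym none) z≤n
  ... | no z≢w   = ≤-trans (consumed-≤ st z) (≼[ w ]⇒≤ a≼b z≢w)

  simulate-step : Tracks b a → Step G a a′ → Simulated b a′
  simulate-step (w , inj₁ refl , a≼b) st =
    replay-tracking (inj₁ refl) a≼b st (λ z → ≤-trans (consumed-≤ st z) (≼[tip]⇒≤ a≼b z))
  simulate-step (w , inj₂ inner , a≼b) st with w ≟ source₁ st | w ≟ source₂ st
  ... | yes refl | _ = absorb-tracking inner a≼b st (source₁-adjacent st) (source₁-≤-consumed st)
  ... | no _ | yes refl = absorb-tracking inner a≼b st (source₂-adjacent st) (source₂-≤-consumed st)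
  ... | no w≢s₁ | no w≢s₂ = replay-tracking (inj₂ inner) a≼b st
    (unconsumed-available a≼b st (cong₂ _+_ (indicator-≢ w≢s₁) (indicator-≢ w≢s₂)))

  simulate : Tracks b a → Star (Step G) a a′ → Simulated b a′
  simulate tracks ε = _ , ε , tracks
  simulate tracks (st ◅ run) with simulate-step tracks st
  ... | _ , run₁ , tracks₁ with simulate tracks₁ run
  ... | b₂ , run₂ , tracks₂ = b₂ , run₁ ◅◅ run₂ , tracks₂

  Tracks⇒≤ : Tracks b a → ∀ {u} → ¬ Inner u → a u ≤ b u
  Tracks⇒≤ (_ , inj₁ refl , a≼b) _ = ≼[tip]⇒≤ a≼b _
  Tracks⇒≤ (w , inj₂ inner , a≼b) u∉ = ≼[ w ]⇒≤ a≼b λ { refl → u∉ inner }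

  roll-preserves-reachability : ∀ {u} (p : Distribution N) → Inner w → 1 ≤ p w → ¬ Inner u →
    Reachable G p u → Reachable G (add tip (remove w p)) u
  roll-preserves-reachability {w = w} p inner 1≤pw u∉ (p′ , run , 1≤p′u)
    with simulate (w , inj₂ inner , roll-≼ p 1≤pw) run
  ... | b′ , run′ , tracks = b′ , run′ , ≤-trans 1≤p′u (Tracks⇒≤ tracks u∉)

distinct-neighbours≤degree : ∀ {N} (G : Graph N) {x} {ys : List (Fin N)} →
  Unique ys → All (Adj G x) ys → length ys ≤ degree G x
distinct-neighbours≤degree G {x} uniq x~ys =
  Unique-⊆⇒length-≤ uniq λ y∈ys →
    ∈-filter⁺ (λ y → adj G x y ≟ᵇ true) (∈-allFin _) (All.lookup x~ys y∈ys)

Adj-sym : ∀ {N} (G : Graph N) {x y} → Adj G x y → Adj G y x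
Adj-sym G {x} {y} x~y = trans (Graph.sym G y x) x~y

fromℕ-or-inject₁ : ∀ {m} (j : Fin (suc m)) → j ≡ fromℕ m ⊎ ∃ λ k → j ≡ inject₁ k
fromℕ-or-inject₁ {zero}  fzero = inj₁ refl
fromℕ-or-inject₁ {suc m} fzero    = inj₂ (fzero , refl)
fromℕ-or-inject₁ {suc m} (fsuc j) with fromℕ-or-inject₁ j
... | inj₁ j≡last     = inj₁ (cong fsuc j≡last)
... | inj₂ (k , j≡k) = inj₂ (fsuc k , cong fsuc j≡k)

module _ {N m} {G : Graph N} {v : Fin (suc m) → Fin N} (arm : IsArm G m v) where
  open IsArm arm

  -- v₁ has degree 1 and v₂,…,vₙ₋₁ degree 2, and their path neighbours already use that up.
  inner-neighbour : ∀ (k : Fin m) {t} → Adj G (v (inject₁ k)) t → ∃ λ j → t ≡ v j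
  inner-neighbour fzero {t} v₁~t with t ≟ v (fsuc fzero)
  ... | yes t≡v₂ = fsuc fzero , t≡v₂
  ... | no t≢v₂  = contradiction
    (subst (2 ≤_) endDeg
      (distinct-neighbours≤degree G (((t≢v₂ ∘ sym) ∷ []) ∷ [] ∷ []) (path fzero ∷ v₁~t ∷ [])))
    λ { (s≤s ()) }
  inner-neighbour (fsuc k) {t} vₖ~t with t ≟ v (inject₁ (inject₁ k)) | t ≟ v (fsuc (fsuc k))
  ... | yes t≡prev | _        = _ , t≡prev
  ... | no _       | yes t≡next = _ , t≡next
  ... | no t≢prev  | no t≢next = contradiction
    (subst (3 ≤_) (innerDeg (inject₁ (fsuc k)) (s≤s z≤n) (s≤s (inject₁ℕ< k)))
      (distinct-neighbours≤degree G
        ((prev≢next ∷ (t≢prev ∘ sym) ∷ []) ∷ ((t≢next ∘ sym) ∷ []) ∷ [] ∷ [])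
        (Adj-sym G (path (inject₁ k)) ∷ path (fsuc k) ∷ vₖ~t ∷ [])))
    λ { (s≤s (s≤s ())) }
    where
    prev≢next : v (inject₁ (inject₁ k)) ≢ v (fsuc (fsuc k))
    prev≢next prev≡next = <⇒≢ (m<n+m (toℕ k) {2} (s≤s z≤n))
      (trans (sym (trans (toℕ-inject₁ (inject₁ k)) (toℕ-inject₁ k)))
             (cong toℕ (distinct prev≡next)))

  inner-closed : ∀ {w t} → (∃ λ k → w ≡ v (inject₁ k)) → Adj G w t →
    t ≡ v (fromℕ m) ⊎ ∃ λ k → t ≡ v (inject₁ k)
  inner-closed (k , refl) w~t with inner-neighbour k w~t
  ... | j , refl with fromℕ-or-inject₁ j
  ...   | inj₁ refl       = inj₁ refl
  ...   | inj₂ (k′ , refl) = inj₂ (k′ , refl)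

mainTheorem14 : ∀ {N : ℕ} (G : Graph N) (m : ℕ) (v : Fin (suc m) → Fin N)
    → IsArm G m v
    → (p : Distribution N) (i : Fin m)
    → 2 ≤ p (v (inject₁ i))
    → p (v (fromℕ m)) ≡ 0
    → (∀ (j : Fin m) → 1 ≤ p (v (inject₁ j)))
    → (u : Fin N)
    → Reachable G p u
    → Reachable G (add (v (fromℕ m)) (remove (v (inject₁ i)) p)) u
mainTheorem14 G m v arm p i 2≤pvᵢ _ inner-occupied u reachable
  with any? (λ j → u ≟ v (inject₁ j))
... | yes (j , refl) =
  _ , ε , ≤-trans (remove-≥1 p 2≤pvᵢ _ (inner-occupied j))
                  (≤-add (v (fromℕ m)) (remove (v (inject₁ i)) p) (v (inject₁ j)))
... | no u∉inner =
  roll-preserves-reachability p (i , refl) (≤-trans (s≤s z≤n) 2≤pvᵢ) u∉inner reachable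
  where open Rolling G (v (fromℕ m)) (λ x → ∃ λ k → x ≡ v (inject₁ k)) (inner-closed arm)
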